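{- Let $n\ge 1$ be odd, $n_1=(n+1)/2$, $n_0=(n-1)/2$. Suppose $k\in K_0(\mathfrak{p})$ and $g\in\{1,\begin{smallmatrix}0&1\\ \varpi&0\end{smallmatrix}\}$. Then $kgwa(\varpi^{n_1})=k'a(\varpi^{n_1})g'z$ for some $k'\in K$ with $l(k'a(\varpi^{n_1}))\le n_0$, some $g'\in\{1,\begin{smallmatrix}0&1\\ \varpi^n&0\end{smallmatrix}\}$ and some $z\in Z$.
   Context: $F$ is a non-archimedean local field of characteristic zero, $\mathfrak{o}$ its ring of integers, $\mathfrak{p}$ the maximal ideal, $\varpi$ a uniformizer. $G=\mathrm{GL}_2(F)$, $K=\mathrm{GL}_2(\mathfrak{o})$, $K_0(\mathfrak{p})=\{\begin{smallmatrix} a&b\\c&d\end{smallmatrix}\in K: c\in\mathfrak{p}\}$, $K_1(\mathfrak{p}^k)=\{\begin{smallmatrix} a&b\\c&d\end{smallmatrix}\in K: c\in\mathfrak{p}^k,\ a\in1+\mathfrak{p}^k\}$, $w=\begin{smallmatrix}0&1\\-1&0\end{smallmatrix}$, $a(y)=\mathrm{diag}(y,1)$, $n(x)=\begin{smallmatrix}1&x\\0&1\end{smallmatrix}$, $N=\{n(x)\}$, $Z$ the center. Every $h\in G$ lies in $ZNa(\varpi^t)wn(\varpi^{ -l}v)K_1(\mathfrak{p}^n)$ for a unique pair of integers $(t,l)$ with $0\le l\le n$ and some $v\in\mathfrak{o}^\times$; $l(h)$ denotes this $l$. -}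

module Defs where

open import Level using (Level; _⊔_) renaming (suc to lsuc)
open import Algebra.Bundles using (CommutativeRing)
open import Data.Nat as ℕ using (ℕ; zero; suc)
open import Data.Integer as ℤ using (ℤ; +_; -[1+_])
open import Data.List using (List)
open import Data.List.Membership.Propositional using (_∈_)
open import Data.Product using (Σ; ∃; ∃-syntax; _×_; _,_)
open import Data.Sum using (_⊎_)
open import Relation.Nullary using (¬_)
open import Relation.Binary.PropositionalEquality using (_≡_)

-- Non-archimedean local field of characteristic zero, axiomatised:
-- a field (with a total inverse function, meaningful on nonzero elements),
-- of characteristic zero, with a discrete (ℤ-valued, normalised) valuation,
-- a uniformizer ϖ, finite residue field, and complete w.r.t. the valuation.

module RingDefs {c ℓ : Level} (R : CommutativeRing c ℓ) where
  open CommutativeRing R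

  natCast : ℕ → Carrier
  natCast zero    = 0#
  natCast (suc n) = 1# + natCast n

  pow : Carrier → ℕ → Carrier
  pow x zero    = 1#
  pow x (suc n) = x * pow x n

module ValDefs {c ℓ : Level} (R : CommutativeRing c ℓ) (val : CommutativeRing.Carrier R → ℤ) where
  open CommutativeRing R

  -- x ∈ 𝔭^k  (k : ℤ),  i.e. val x ≥ k (or x = 0)
  InPow : ℤ → Carrier → Set ℓ
  InPow k x = (x ≈ 0#) ⊎ (¬ (x ≈ 0#) × (k ℤ.≤ val x))

  Int : Carrier → Set ℓ
  Int = InPow (+ 0)

  Unit : Carrier → Set ℓ
  Unit x = ¬ (x ≈ 0#) × (val x ≡ + 0)

record NALocalField (c ℓ : Level) : Set (lsuc (c ⊔ ℓ)) where
  field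
    cring : CommutativeRing c ℓ
  open CommutativeRing cring public

  field
    0≉1      : ¬ (0# ≈ 1#)
    _⁻¹      : Carrier → Carrier
    inverse  : ∀ x → ¬ (x ≈ 0#) → (x * (x ⁻¹)) ≈ 1#
    charZero : ∀ n → ¬ (RingDefs.natCast cring (suc n) ≈ 0#)
    -- valuation (its value at 0 is irrelevant; 0 has valuation +∞)
    val      : Carrier → ℤ
    val-cong : ∀ {x y} → x ≈ y → ¬ (x ≈ 0#) → val x ≡ val y
    val-*    : ∀ x y → ¬ (x ≈ 0#) → ¬ (y ≈ 0#) → val (x * y) ≡ val x ℤ.+ val y
    val-+    : ∀ x y → ¬ (x ≈ 0#) → ¬ (y ≈ 0#) → ¬ ((x + y) ≈ 0#) →
               (val x ℤ.⊓ val y) ℤ.≤ val (x + y)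
    ϖ        : Carrier
    ϖ≉0      : ¬ (ϖ ≈ 0#)
    val-ϖ    : val ϖ ≡ + 1

  field
    residueFinite : ∃[ reps ] (∀ r → r ∈ reps → ValDefs.Int cring val r) ×
                      (∀ x → ValDefs.Int cring val x → ∃[ r ] (r ∈ reps × ValDefs.InPow cring val (+ 1) (x - r)))
    complete : (s : ℕ → Carrier) →
               (∀ (k : ℕ) → ∃[ N ] ∀ m m′ → N ℕ.≤ m → N ℕ.≤ m′ → ValDefs.InPow cring val (+ k) (s m - s m′)) →
               ∃[ L ] ∀ (k : ℕ) → ∃[ N ] ∀ m → N ℕ.≤ m → ValDefs.InPow cring val (+ k) (s m - L)

  open RingDefs cring public
  open ValDefs cring val public

  ϖ^ : ℤ → Carrier
  ϖ^ (+ n)     = pow ϖ n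
  ϖ^ -[1+ n ]  = (pow ϖ (suc n)) ⁻¹

record Mat2 {c : Level} (A : Set c) : Set c where
  constructor mat
  field
    e11 e12 e21 e22 : A
open Mat2 public

module GL2 {c ℓ : Level} (F : NALocalField c ℓ) where
  open NALocalField F public

  M2 : Set c
  M2 = Mat2 Carrier

  _·_ : M2 → M2 → M2
  mat a b c′ d · mat a′ b′ c″ d′ =
    mat (a * a′ + b * c″) (a * b′ + b * d′) (c′ * a′ + d * c″) (c′ * b′ + d * d′)
  infixl 7 _·_

  _≈M_ : M2 → M2 → Set ℓ
  A ≈M B = (e11 A ≈ e11 B) × (e12 A ≈ e12 B) × (e21 A ≈ e21 B) × (e22 A ≈ e22 B)

  det : M2 → Carrier
  det (mat a b c′ d) = a * d - b * c′

  InK : M2 → Set ℓ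
  InK (mat a b c′ d) = Int a × Int b × Int c′ × Int d × Unit (a * d - b * c′)

  InK0p : M2 → Set ℓ
  InK0p A = InK A × InPow (+ 1) (e21 A)

  InK1 : ℕ → M2 → Set ℓ
  InK1 k A = InK A × InPow (+ k) (e21 A) × InPow (+ k) (e11 A - 1#)

  one : M2
  one = mat 1# 0# 0# 1#

  w : M2
  w = mat 0# 1# (- 1#) 0#

  a : Carrier → M2
  a y = mat y 0# 0# 1#

  n : Carrier → M2
  n x = mat 1# x 0# 1#

  scalar : Carrier → M2
  scalar λ′ = mat λ′ 0# 0# λ′

  -- h ∈ Z N a(ϖ^t) w n(ϖ^{-l} v) K₁(𝔭^N) for some t, v ∈ 𝔬ˣ
  -- (the paper's l(h) is the unique such l with 0 ≤ l ≤ N)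
  HasL : (N : ℕ) → M2 → ℕ → Set (c ⊔ ℓ)
  HasL N h l = l ℕ.≤ N × ∃[ λ′ ] ∃[ x ] ∃[ t ] ∃[ v ] ∃[ k ]
    (¬ (λ′ ≈ 0#) × Unit v × InK1 N k ×
     (h ≈M (scalar λ′ · n x · a (ϖ^ t) · w · n (ϖ^ (ℤ.- (+ l)) * v) · k)))

  lLeq : (N : ℕ) → M2 → ℕ → Set (c ⊔ ℓ)
  lLeq N h m = ∃[ l ] (HasL N h l × l ℕ.≤ m)

{-# OPTIONS --safe #-}
-- In both cases k′ = kw works: k·w·a(ϖ^{n₁}) = kw·a(ϖ^{n₁}) for g = 1, while for g = [[0,1],[ϖ,0]]
-- k·g·w·a(ϖ^{n₁}) = kw·a(ϖ^{n₁})·[[0,1],[ϖⁿ,0]]·(−ϖ^{−n₀}). As k ∈ K₀(𝔭), its entry d is a unit and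
-- c ∈ 𝔭, so kw = [[−b,a],[−d,c]] has a unit lower-left entry. A matrix [[a,b],[c,d]]·a(π) with c a unit
-- factors as λ n(a/c) a(π⁻¹) w n(y) [[1,β],[0,δ]] with λ = −cπ, δ = det/c² and yδ = d/(cπ) − β for any β.
-- Since val(d/(cπ)) ≥ 1 − n₁ = −n₀, some β ∈ 𝔬 makes yδ equal to ϖ^{−l} times a unit with l ≤ n₀.
module Submission where

open import Defs

open import Algebra.Bundles using (CommutativeRing)
import Algebra.Properties.AbelianGroup as AbelianGroupProperties
import Algebra.Properties.CommutativeSemigroup as CommutativeSemigroupProperties
import Algebra.Properties.Ring as RingProperties
import Algebra.Properties.Semiring.Mult.TCOptimised as SemiringMultiplication
import Algebra.Solver.Ring as RingSolver
open import Algebra.Solver.Ring.AlmostCommutativeRing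
  using (_-Raw-AlmostCommutative⟶_; fromCommutativeRing)
open import Data.Empty using (⊥-elim)
open import Data.Integer as ℤ using (ℤ; +_; -[1+_]; _⊖_)
import Data.Integer.Properties as ℤP
open import Data.Maybe using (Maybe; map)
open import Data.Nat as ℕ using (ℕ; zero; suc)
import Data.Nat.Properties as ℕP
open import Data.Product using (∃-syntax; _×_; _,_; proj₁)
open import Data.Sign as Sign using (Sign)
open import Data.Sum using (_⊎_; inj₁; inj₂)
open import Relation.Binary.Consequences using (dec⇒weaklyDec)
open import Relation.Binary.PropositionalEquality as P using (_≡_)
import Relation.Binary.Reasoning.Setoid as SetoidReasoning
open import Relation.Nullary using (¬_)

-- The ring solver for an arbitrary commutative ring needs coefficients mapping into it; ℤ is used so
-- that negatives cancel. The type-checking-optimised n ×′ 1# makes ⟦ + 1 ⟧ℤ reduce to 1#, so the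
-- evaluated solver goals match the entries of the GL₂ matrices definitionally.
module IntegerCoefficientSolver {c ℓ} (R : CommutativeRing c ℓ) where
  open CommutativeRing R
  open RingProperties ring
  open CommutativeSemigroupProperties +-commutativeSemigroup using (interchange)
  open SemiringMultiplication semiring using (1+×; ×-cong; ×-homo-+; ×1-homo-*)
    renaming (_×_ to _×′_)
  open SetoidReasoning setoid

  ⟦_⟧ℤ : ℤ → Carrier
  ⟦ + n ⟧ℤ      = n ×′ 1#
  ⟦ -[1+ n ] ⟧ℤ = - (suc n ×′ 1#)

  x-y≈[1+x]-[1+y] : ∀ x y → x - y ≈ (1# + x) - (1# + y)
  x-y≈[1+x]-[1+y] x y = begin
    x - y                  ≈⟨ +-identityˡ _ ⟨
    0# + (x - y)           ≈⟨ +-congʳ (-‿inverseʳ 1#) ⟨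
    (1# - 1#) + (x - y)    ≈⟨ interchange 1# (- 1#) x (- y) ⟩
    (1# + x) + (- 1# - y)  ≈⟨ +-congˡ (-‿+-comm 1# y) ⟩
    (1# + x) - (1# + y)    ∎

  ⊖-homo : ∀ m n → ⟦ m ⊖ n ⟧ℤ ≈ m ×′ 1# - n ×′ 1#
  ⊖-homo zero    zero    = sym (trans (+-congˡ -0#≈0#) (+-identityʳ 0#))
  ⊖-homo zero    (suc n) = sym (+-identityˡ _)
  ⊖-homo (suc m) zero    = sym (trans (+-congˡ -0#≈0#) (+-identityʳ _))
  ⊖-homo (suc m) (suc n) = begin
    ⟦ suc m ⊖ suc n ⟧ℤ               ≡⟨ P.cong ⟦_⟧ℤ (ℤP.[1+m]⊖[1+n]≡m⊖n m n) ⟩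
    ⟦ m ⊖ n ⟧ℤ                       ≈⟨ ⊖-homo m n ⟩
    m ×′ 1# - n ×′ 1#                ≈⟨ x-y≈[1+x]-[1+y] _ _ ⟩
    (1# + m ×′ 1#) - (1# + n ×′ 1#)  ≈⟨ +-cong (1+× m 1#) (-‿cong (1+× n 1#)) ⟨
    suc m ×′ 1# - suc n ×′ 1#        ∎

  +-homo : ∀ i j → ⟦ i ℤ.+ j ⟧ℤ ≈ ⟦ i ⟧ℤ + ⟦ j ⟧ℤ
  +-homo (+ m)    (+ n)    = ×-homo-+ 1# m n
  +-homo (+ m)    -[1+ n ] = ⊖-homo m (suc n)
  +-homo -[1+ m ] (+ n)    = trans (⊖-homo n (suc m)) (+-comm _ _)
  +-homo -[1+ m ] -[1+ n ] = begin
    - (suc (suc (m ℕ.+ n)) ×′ 1#)      ≈⟨ -‿cong (×-cong (P.sym (ℕP.+-suc (suc m) n)) refl) ⟩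
    - ((suc m ℕ.+ suc n) ×′ 1#)        ≈⟨ -‿cong (×-homo-+ 1# (suc m) (suc n)) ⟩
    - (suc m ×′ 1# + suc n ×′ 1#)      ≈⟨ -‿+-comm _ _ ⟨
    - (suc m ×′ 1#) + - (suc n ×′ 1#)  ∎

  -‿homo : ∀ i → ⟦ ℤ.- i ⟧ℤ ≈ - ⟦ i ⟧ℤ
  -‿homo (+ zero)  = sym -0#≈0#
  -‿homo (+ suc n) = refl
  -‿homo -[1+ n ]  = sym (-‿involutive _)

  +◃-homo : ∀ n → ⟦ Sign.+ ℤ.◃ n ⟧ℤ ≈ n ×′ 1#
  +◃-homo zero    = refl
  +◃-homo (suc n) = refl

  -◃-homo : ∀ n → ⟦ Sign.- ℤ.◃ n ⟧ℤ ≈ - (n ×′ 1#)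
  -◃-homo zero    = sym -0#≈0#
  -◃-homo (suc n) = refl

  *-homo : ∀ i j → ⟦ i ℤ.* j ⟧ℤ ≈ ⟦ i ⟧ℤ * ⟦ j ⟧ℤ
  *-homo (+ m) (+ n) = trans (+◃-homo (m ℕ.* n)) (×1-homo-* m n)
  *-homo (+ m) -[1+ n ] = begin
    ⟦ Sign.- ℤ.◃ (m ℕ.* suc n) ⟧ℤ  ≈⟨ -◃-homo (m ℕ.* suc n) ⟩
    - ((m ℕ.* suc n) ×′ 1#)        ≈⟨ -‿cong (×1-homo-* m (suc n)) ⟩
    - (m ×′ 1# * suc n ×′ 1#)      ≈⟨ -‿distribʳ-* _ _ ⟩
    m ×′ 1# * - (suc n ×′ 1#)      ∎
  *-homo -[1+ m ] (+ n) = begin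
    ⟦ Sign.- ℤ.◃ (suc m ℕ.* n) ⟧ℤ  ≈⟨ -◃-homo (suc m ℕ.* n) ⟩
    - ((suc m ℕ.* n) ×′ 1#)        ≈⟨ -‿cong (×1-homo-* (suc m) n) ⟩
    - (suc m ×′ 1# * n ×′ 1#)      ≈⟨ -‿distribˡ-* _ _ ⟩
    - (suc m ×′ 1#) * n ×′ 1#      ∎
  *-homo -[1+ m ] -[1+ n ] = begin
    ⟦ Sign.+ ℤ.◃ (suc m ℕ.* suc n) ⟧ℤ  ≈⟨ +◃-homo (suc m ℕ.* suc n) ⟩
    (suc m ℕ.* suc n) ×′ 1#            ≈⟨ ×1-homo-* (suc m) (suc n) ⟩
    suc m ×′ 1# * suc n ×′ 1#          ≈⟨ -‿involutive _ ⟨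
    - - (suc m ×′ 1# * suc n ×′ 1#)    ≈⟨ -‿cong (-‿distribˡ-* _ _) ⟩
    - (- (suc m ×′ 1#) * suc n ×′ 1#)  ≈⟨ -‿distribʳ-* _ _ ⟩
    - (suc m ×′ 1#) * - (suc n ×′ 1#)  ∎

  ℤ⟶R : ℤ.+-*-rawRing -Raw-AlmostCommutative⟶ fromCommutativeRing R
  ℤ⟶R = record
    { ⟦_⟧    = ⟦_⟧ℤ
    ; +-homo = +-homo
    ; *-homo = *-homo
    ; -‿homo = -‿homo
    ; 0-homo = refl
    ; 1-homo = refl
    }

  ⟦⟧ℤ-≡? : ∀ i j → Maybe (⟦ i ⟧ℤ ≈ ⟦ j ⟧ℤ)
  ⟦⟧ℤ-≡? i j = map (λ { P.refl → refl }) (dec⇒weaklyDec ℤ._≟_ i j)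

  open RingSolver ℤ.+-*-rawRing (fromCommutativeRing R) ℤ⟶R ⟦⟧ℤ-≡? public

  0ₚ 1ₚ : ∀ {k} → Polynomial k
  0ₚ = con (+ 0)
  1ₚ = con (+ 1)

  -- The solver cannot use hypotheses: an identity holding modulo two relations xᵢ ≈ yᵢ is proved
  -- by letting the solver exhibit lhs − rhs as an explicit combination of the xᵢ − yᵢ.
  by-relations : ∀ {lhs rhs x₁ y₁ x₂ y₂ c₁ c₂} → x₁ ≈ y₁ → x₂ ≈ y₂ →
                 lhs ≈ rhs + (c₁ * (x₁ - y₁) + c₂ * (x₂ - y₂)) → lhs ≈ rhs
  by-relations {lhs} {rhs} {x₁} {y₁} {x₂} {y₂} {c₁} {c₂} x₁≈y₁ x₂≈y₂ lhs≈ = begin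
    lhs                                      ≈⟨ lhs≈ ⟩
    rhs + (c₁ * (x₁ - y₁) + c₂ * (x₂ - y₂))  ≈⟨ +-congˡ (+-cong (vanish x₁≈y₁) (vanish x₂≈y₂)) ⟩
    rhs + (0# + 0#)                          ≈⟨ +-congˡ (+-identityʳ 0#) ⟩
    rhs + 0#                                 ≈⟨ +-identityʳ rhs ⟩
    rhs                                      ∎
    where
    vanish : ∀ {a x y} → x ≈ y → a * (x - y) ≈ 0#
    vanish {a} {x} {y} x≈y = trans (*-congˡ (trans (+-congʳ x≈y) (-‿inverseʳ y))) (zeroʳ a)

module LocalFieldProperties {c ℓ} (F : NALocalField c ℓ) where
  open NALocalField F
  open RingProperties ring
  open AbelianGroupProperties ℤP.+-0-abelianGroup using (identityʳ-unique; inverseʳ-unique)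
  open IntegerCoefficientSolver cring using (solve; _:=_; 0ₚ; 1ₚ; _:+_; _:-_; _:*_; :-_)
  private module ≈-Reasoning = SetoidReasoning setoid

  1≉0 : 1# ≉ 0#
  1≉0 1≈0 = 0≉1 (sym 1≈0)

  x*y≉0 : ∀ {x y} → x ≉ 0# → y ≉ 0# → x * y ≉ 0#
  x*y≉0 {x} {y} x≉0 y≉0 xy≈0 = y≉0 (begin
    y               ≈⟨ *-identityˡ y ⟨
    1# * y          ≈⟨ *-congʳ (trans (*-comm _ _) (inverse x x≉0)) ⟨
    (x ⁻¹ * x) * y  ≈⟨ *-assoc _ _ _ ⟩
    x ⁻¹ * (x * y)  ≈⟨ *-congˡ xy≈0 ⟩
    x ⁻¹ * 0#       ≈⟨ zeroʳ _ ⟩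
    0#              ∎)
    where open ≈-Reasoning

  x⁻¹≉0 : ∀ {x} → x ≉ 0# → x ⁻¹ ≉ 0#
  x⁻¹≉0 {x} x≉0 x⁻¹≈0 = 0≉1 (begin
    0#        ≈⟨ zeroʳ x ⟨
    x * 0#    ≈⟨ *-congˡ x⁻¹≈0 ⟨
    x * x ⁻¹  ≈⟨ inverse x x≉0 ⟩
    1#        ∎)
    where open ≈-Reasoning

  -x≉0 : ∀ {x} → x ≉ 0# → - x ≉ 0#
  -x≉0 {x} x≉0 -x≈0 = x≉0 (begin
    x      ≈⟨ -‿involutive x ⟨
    - - x  ≈⟨ -‿cong -x≈0 ⟩
    - 0#   ≈⟨ -0#≈0# ⟩
    0#     ∎)
    where open ≈-Reasoning

  pow-≉0 : ∀ n → pow ϖ n ≉ 0#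
  pow-≉0 zero    = 1≉0
  pow-≉0 (suc n) = x*y≉0 ϖ≉0 (pow-≉0 n)

  ϖ^-≉0 : ∀ t → ϖ^ t ≉ 0#
  ϖ^-≉0 (+ n)     = pow-≉0 n
  ϖ^-≉0 -[1+ n ]  = x⁻¹≉0 (pow-≉0 (suc n))

  pow-+ : ∀ x m n → pow x (m ℕ.+ n) ≈ pow x m * pow x n
  pow-+ x zero    n = sym (*-identityˡ _)
  pow-+ x (suc m) n = trans (*-congˡ (pow-+ x m n)) (sym (*-assoc _ _ _))

  pow-2* : ∀ x m → pow x (2 ℕ.* m) ≈ pow x m * pow x m
  pow-2* x m = trans (pow-+ x m (m ℕ.+ 0)) (*-congˡ (reflexive (P.cong (pow x) (ℕP.+-identityʳ m))))

  [x*y]*y⁻¹≈x : ∀ {x y} → y ≉ 0# → (x * y) * y ⁻¹ ≈ x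
  [x*y]*y⁻¹≈x {x} {y} y≉0 = begin
    (x * y) * y ⁻¹  ≈⟨ *-assoc x y _ ⟩
    x * (y * y ⁻¹)  ≈⟨ *-congˡ (inverse y y≉0) ⟩
    x * 1#          ≈⟨ *-identityʳ x ⟩
    x               ∎
    where open ≈-Reasoning

  [x*y⁻¹]*y≈x : ∀ {x y} → y ≉ 0# → (x * y ⁻¹) * y ≈ x
  [x*y⁻¹]*y≈x {x} {y} y≉0 = begin
    (x * y ⁻¹) * y  ≈⟨ *-assoc x _ y ⟩
    x * (y ⁻¹ * y)  ≈⟨ *-congˡ (trans (*-comm _ y) (inverse y y≉0)) ⟩
    x * 1#          ≈⟨ *-identityʳ x ⟩
    x               ∎
    where open ≈-Reasoning

  val-1 : val 1# ≡ + 0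
  val-1 = identityʳ-unique (val 1#) (val 1#) (begin
    val 1# ℤ.+ val 1#  ≡⟨ val-* 1# 1# 1≉0 1≉0 ⟨
    val (1# * 1#)      ≡⟨ val-cong (*-identityˡ 1#) (x*y≉0 1≉0 1≉0) ⟩
    val 1#             ∎)
    where open P.≡-Reasoning

  val-⁻¹ : ∀ {x} → x ≉ 0# → val (x ⁻¹) ≡ ℤ.- val x
  val-⁻¹ {x} x≉0 = inverseʳ-unique (val x) (val (x ⁻¹)) (begin
    val x ℤ.+ val (x ⁻¹)  ≡⟨ val-* x (x ⁻¹) x≉0 (x⁻¹≉0 x≉0) ⟨
    val (x * x ⁻¹)        ≡⟨ val-cong (inverse x x≉0) (x*y≉0 x≉0 (x⁻¹≉0 x≉0)) ⟩
    val 1#                ≡⟨ val-1 ⟩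
    + 0                   ∎)
    where open P.≡-Reasoning

  z+z≡0⇒z≡0 : ∀ z → z ℤ.+ z ≡ + 0 → z ≡ + 0
  z+z≡0⇒z≡0 (+ zero) _ = P.refl

  val-‿1 : val (- 1#) ≡ + 0
  val-‿1 = z+z≡0⇒z≡0 (val (- 1#)) (begin
    val (- 1#) ℤ.+ val (- 1#)  ≡⟨ val-* (- 1#) (- 1#) -1≉0 -1≉0 ⟨
    val (- 1# * - 1#)          ≡⟨ val-cong -1*-1≈1 (x*y≉0 -1≉0 -1≉0) ⟩
    val 1#                     ≡⟨ val-1 ⟩
    + 0                        ∎)
    where
    open P.≡-Reasoning
    -1≉0 = -x≉0 1≉0
    -1*-1≈1 : - 1# * - 1# ≈ 1#
    -1*-1≈1 = trans (-1*x≈-x (- 1#)) (-‿involutive 1#)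

  val-‿ : ∀ {x} → x ≉ 0# → val (- x) ≡ val x
  val-‿ {x} x≉0 = begin
    val (- x)             ≡⟨ val-cong (sym (-1*x≈-x x)) (-x≉0 x≉0) ⟩
    val (- 1# * x)        ≡⟨ val-* (- 1#) x (-x≉0 1≉0) x≉0 ⟩
    val (- 1#) ℤ.+ val x  ≡⟨ P.cong (ℤ._+ val x) val-‿1 ⟩
    + 0 ℤ.+ val x         ≡⟨ ℤP.+-identityˡ (val x) ⟩
    val x                 ∎
    where open P.≡-Reasoning

  val-pow : ∀ n → val (pow ϖ n) ≡ + n
  val-pow zero    = val-1
  val-pow (suc n) = begin
    val (ϖ * pow ϖ n)        ≡⟨ val-* ϖ (pow ϖ n) ϖ≉0 (pow-≉0 n) ⟩
    val ϖ ℤ.+ val (pow ϖ n)  ≡⟨ P.cong₂ ℤ._+_ val-ϖ (val-pow n) ⟩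
    + suc n                  ∎
    where open P.≡-Reasoning

  val-ϖ^ : ∀ t → val (ϖ^ t) ≡ t
  val-ϖ^ (+ n)    = val-pow n
  val-ϖ^ -[1+ n ] = P.trans (val-⁻¹ (pow-≉0 (suc n))) (P.cong ℤ.-_ (val-pow (suc n)))

  InPow-resp : ∀ {k x y} → x ≈ y → InPow k x → InPow k y
  InPow-resp x≈y (inj₁ x≈0)        = inj₁ (trans (sym x≈y) x≈0)
  InPow-resp x≈y (inj₂ (x≉0 , k≤)) =
    inj₂ ((λ y≈0 → x≉0 (trans x≈y y≈0)) , P.subst (_ ℤ.≤_) (val-cong x≈y x≉0) k≤)

  InPow-≤ : ∀ {j k x} → j ℤ.≤ k → InPow k x → InPow j x
  InPow-≤ j≤k (inj₁ x≈0)        = inj₁ x≈0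
  InPow-≤ j≤k (inj₂ (x≉0 , k≤)) = inj₂ (x≉0 , ℤP.≤-trans j≤k k≤)

  InPow-ϖ^ : ∀ t → InPow t (ϖ^ t)
  InPow-ϖ^ t = inj₂ (ϖ^-≉0 t , ℤP.≤-reflexive (P.sym (val-ϖ^ t)))

  InPow-* : ∀ {j k x y} → InPow j x → InPow k y → InPow (j ℤ.+ k) (x * y)
  InPow-* (inj₁ x≈0) _          = inj₁ (trans (*-congʳ x≈0) (zeroˡ _))
  InPow-* (inj₂ _)   (inj₁ y≈0) = inj₁ (trans (*-congˡ y≈0) (zeroʳ _))
  InPow-* {x = x} {y} (inj₂ (x≉0 , j≤)) (inj₂ (y≉0 , k≤)) =
    inj₂ (x*y≉0 x≉0 y≉0 , P.subst (_ ℤ.≤_) (P.sym (val-* x y x≉0 y≉0)) (ℤP.+-mono-≤ j≤ k≤))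

  InPow-‿ : ∀ {k x} → InPow k x → InPow k (- x)
  InPow-‿ (inj₁ x≈0)        = inj₁ (trans (-‿cong x≈0) -0#≈0#)
  InPow-‿ (inj₂ (x≉0 , k≤)) = inj₂ (-x≉0 x≉0 , P.subst (_ ℤ.≤_) (P.sym (val-‿ x≉0)) k≤)

  -- x + y ≈ 0# is undecidable, so the ultrametric inequality needs the sum to be known nonzero.
  InPow-+ : ∀ {k x y} → InPow k x → InPow k y → x + y ≉ 0# → InPow k (x + y)
  InPow-+ (inj₁ x≈0) y∈ _ = InPow-resp (sym (trans (+-congʳ x≈0) (+-identityˡ _))) y∈
  InPow-+ x∈@(inj₂ _) (inj₁ y≈0) _ = InPow-resp (sym (trans (+-congˡ y≈0) (+-identityʳ _))) x∈
  InPow-+ {x = x} {y} (inj₂ (x≉0 , k≤x)) (inj₂ (y≉0 , k≤y)) x+y≉0 =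
    inj₂ (x+y≉0 , ℤP.≤-trans (ℤP.⊓-glb k≤x k≤y) (val-+ x y x≉0 y≉0 x+y≉0))

  Unit-resp : ∀ {x y} → x ≈ y → Unit x → Unit y
  Unit-resp x≈y (x≉0 , val≡0) = (λ y≈0 → x≉0 (trans x≈y y≈0)) , P.trans (P.sym (val-cong x≈y x≉0)) val≡0

  Unit-1 : Unit 1#
  Unit-1 = 1≉0 , val-1

  Unit-* : ∀ {x y} → Unit x → Unit y → Unit (x * y)
  Unit-* {x} {y} (x≉0 , val≡0) (y≉0 , val≡0′) =
    x*y≉0 x≉0 y≉0 , P.trans (val-* x y x≉0 y≉0) (P.cong₂ ℤ._+_ val≡0 val≡0′)

  Unit-⁻¹ : ∀ {x} → Unit x → Unit (x ⁻¹)
  Unit-⁻¹ (x≉0 , val≡0) = x⁻¹≉0 x≉0 , P.trans (val-⁻¹ x≉0) (P.cong ℤ.-_ val≡0)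

  Unit-‿ : ∀ {x} → Unit x → Unit (- x)
  Unit-‿ (x≉0 , val≡0) = -x≉0 x≉0 , P.trans (val-‿ x≉0) val≡0

  Unit⇒Int : ∀ {x} → Unit x → Int x
  Unit⇒Int (x≉0 , val≡0) = inj₂ (x≉0 , ℤP.≤-reflexive (P.sym val≡0))

  Unit⇒∉𝔭 : ∀ {x} → Unit x → ¬ InPow (+ 1) x
  Unit⇒∉𝔭 (x≉0 , _)     (inj₁ x≈0)        = x≉0 x≈0
  Unit⇒∉𝔭 (_   , val≡0) (inj₂ (_ , 1≤val)) =
    ℕP.1+n≰n (ℤP.drop‿+≤+ (P.subst (+ 1 ℤ.≤_) val≡0 1≤val))

  Int∧∉𝔭⇒Unit : ∀ {x} → Int x → ¬ InPow (+ 1) x → Unit x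
  Int∧∉𝔭⇒Unit (inj₁ x≈0)            x∉𝔭 = ⊥-elim (x∉𝔭 (inj₁ x≈0))
  Int∧∉𝔭⇒Unit (inj₂ (x≉0 , 0≤val)) x∉𝔭 =
    x≉0 , ℤP.≤-antisym (ℤP.i<j⇒i≤pred[j] (ℤP.≰⇒> λ 1≤val → x∉𝔭 (inj₂ (x≉0 , 1≤val)))) 0≤val

  Unit-+𝔭 : ∀ {u q} → Unit u → InPow (+ 1) q → Unit (u + q)
  Unit-+𝔭 {u} {q} u-unit q∈𝔭 =
    Int∧∉𝔭⇒Unit (InPow-+ (Unit⇒Int u-unit) (InPow-≤ (ℤ.+≤+ ℕ.z≤n) q∈𝔭) u+q≉0) u+q∉𝔭
    where
    u+q≉0 : u + q ≉ 0#
    u+q≉0 u+q≈0 = Unit⇒∉𝔭 u-unit (InPow-resp (sym (+-inverseˡ-unique u q u+q≈0)) (InPow-‿ q∈𝔭))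
    u+q∉𝔭 : ¬ InPow (+ 1) (u + q)
    u+q∉𝔭 u+q∈𝔭 = Unit⇒∉𝔭 u-unit
      (InPow-resp [u+q]-q≈u (InPow-+ u+q∈𝔭 (InPow-‿ q∈𝔭) λ ≈0 → proj₁ u-unit (trans (sym [u+q]-q≈u) ≈0)))
      where
      [u+q]-q≈u : (u + q) - q ≈ u
      [u+q]-q≈u = solve 2 (λ u q → (u :+ q) :- q := u) refl u q

  Int-0 : Int 0#
  Int-0 = inj₁ refl

  Int-‿1 : Int (- 1#)
  Int-‿1 = Unit⇒Int (Unit-‿ Unit-1)

  𝔭-representative : ∀ {s} → InPow (+ 1) s →
    ∃[ β ] ∃[ u ] (Int β × Unit u × s - β ≈ ϖ^ (+ 0) * u)
  𝔭-representative {s} s∈𝔭 =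
    - 1# , 1# + s , Int-‿1 , Unit-+𝔭 Unit-1 s∈𝔭 ,
    solve 1 (λ s → s :- (:- 1ₚ) := 1ₚ :* (1ₚ :+ s)) refl s

  𝔭⁻ⁿ-representative : ∀ n {s} → InPow (ℤ.- + n) s →
    ∃[ l ] (l ℕ.≤ n × ∃[ β ] ∃[ u ] (Int β × Unit u × s - β ≈ ϖ^ (ℤ.- + l) * u))
  𝔭⁻ⁿ-representative n (inj₁ s≈0) = 0 , ℕ.z≤n , 𝔭-representative (inj₁ s≈0)
  𝔭⁻ⁿ-representative n {s} (inj₂ (s≉0 , -n≤val)) with val s in val≡
  ... | + suc j  = 0 , ℕ.z≤n ,
    𝔭-representative (inj₂ (s≉0 , P.subst (+ 1 ℤ.≤_) (P.sym val≡) (ℤ.+≤+ (ℕ.s≤s ℕ.z≤n))))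
  ... | + zero   = 0 , ℕ.z≤n , 0# , s , Int-0 , (s≉0 , val≡) ,
    solve 1 (λ s → s :- 0ₚ := 1ₚ :* s) refl s
  ... | -[1+ j ] = suc j , ℤP.drop‿+≤+ (ℤP.neg-cancel-≤ -n≤val) , 0# , s * π , Int-0 , sπ-unit , s≈π⁻¹sπ
    where
    open ≈-Reasoning
    π = pow ϖ (suc j)
    sπ-unit : Unit (s * π)
    sπ-unit = x*y≉0 s≉0 (pow-≉0 (suc j)) , P.trans (val-* s π s≉0 (pow-≉0 (suc j)))
      (P.trans (P.cong₂ ℤ._+_ val≡ (val-pow (suc j))) (ℤP.+-inverseˡ (+ suc j)))
    s≈π⁻¹sπ : s - 0# ≈ π ⁻¹ * (s * π)
    s≈π⁻¹sπ = begin
      s - 0#          ≈⟨ +-congˡ -0#≈0# ⟩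
      s + 0#          ≈⟨ +-identityʳ s ⟩
      s               ≈⟨ [x*y]*y⁻¹≈x (pow-≉0 (suc j)) ⟨
      (s * π) * π ⁻¹  ≈⟨ *-comm _ _ ⟩
      π ⁻¹ * (s * π)  ∎

module GL2Properties {c ℓ} (F : NALocalField c ℓ) where
  open GL2 F
  open LocalFieldProperties F
  open IntegerCoefficientSolver cring
    using (solve; _:=_; Polynomial; 0ₚ; 1ₚ; _:+_; _:-_; _:*_; :-_; by-relations)
  private module ≈-Reasoning = SetoidReasoning setoid

  ≈M-sym : ∀ {M M′} → M ≈M M′ → M′ ≈M M
  ≈M-sym (p₁₁ , p₁₂ , p₂₁ , p₂₂) = sym p₁₁ , sym p₁₂ , sym p₂₁ , sym p₂₂

  -- Polynomial counterparts of the GL₂ matrices, whose entries evaluate definitionally to theirs,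
  -- so that matrix identities can be handed to the solver entrywise.
  Mₚ : ℕ → Set
  Mₚ k = Mat2 (Polynomial k)

  infixl 7 _·ₚ_
  _·ₚ_ : ∀ {k} → Mₚ k → Mₚ k → Mₚ k
  mat a₁ b₁ c₁ d₁ ·ₚ mat a₂ b₂ c₂ d₂ =
    mat (a₁ :* a₂ :+ b₁ :* c₂) (a₁ :* b₂ :+ b₁ :* d₂) (c₁ :* a₂ :+ d₁ :* c₂) (c₁ :* b₂ :+ d₁ :* d₂)

  oneₚ wₚ : ∀ {k} → Mₚ k
  oneₚ = mat 1ₚ 0ₚ 0ₚ 1ₚ
  wₚ   = mat 0ₚ 1ₚ (:- 1ₚ) 0ₚ

  aₚ nₚ scalarₚ : ∀ {k} → Polynomial k → Mₚ k
  aₚ y      = mat y 0ₚ 0ₚ 1ₚ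
  nₚ x      = mat 1ₚ x 0ₚ 1ₚ
  scalarₚ λ′ = mat λ′ 0ₚ 0ₚ λ′

  bruhatCell : ∀ {A B C D Ci π q y} → C * Ci ≈ 1# → π * q ≈ 1# →
    let δ = (A * D - B * C) * Ci * Ci in
    (scalar (- (C * π)) · n (A * Ci) · a q · w · n y · mat 1# (Ci * D * q - y * δ) 0# δ) ≈M (mat A B C D · a π)
  bruhatCell {A} {B} {C} {D} {Ci} {π} {q} {y} CCi≈1 πq≈1 =
    by-relations CCi≈1 πq≈1 (solve 8 (λ A B C D Ci π q y →
      e11 (cellₚ A B C D Ci π q y) := e11 (mat A B C D ·ₚ aₚ π) :+
        ((A :* π) :* (C :* Ci :- 1ₚ) :+ 0ₚ :* (π :* q :- 1ₚ))) refl A B C D Ci π q y) ,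
    by-relations CCi≈1 πq≈1 (solve 8 (λ A B C D Ci π q y →
      e12 (cellₚ A B C D Ci π q y) := e12 (mat A B C D ·ₚ aₚ π) :+
        ((B :* (C :* Ci :+ 1ₚ) :* (π :* q)) :* (C :* Ci :- 1ₚ) :+ B :* (π :* q :- 1ₚ))) refl A B C D Ci π q y) ,
    solve 8 (λ A B C D Ci π q y → e21 (cellₚ A B C D Ci π q y) := e21 (mat A B C D ·ₚ aₚ π)) refl A B C D Ci π q y ,
    by-relations CCi≈1 πq≈1 (solve 8 (λ A B C D Ci π q y →
      e22 (cellₚ A B C D Ci π q y) := e22 (mat A B C D ·ₚ aₚ π) :+
        ((D :* (π :* q)) :* (C :* Ci :- 1ₚ) :+ D :* (π :* q :- 1ₚ))) refl A B C D Ci π q y)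
    where
    cellₚ : ∀ {k} (A B C D Ci π q y : Polynomial k) → Mₚ k
    cellₚ A B C D Ci π q y = scalarₚ (:- (C :* π)) ·ₚ nₚ (A :* Ci) ·ₚ aₚ q ·ₚ wₚ ·ₚ nₚ y ·ₚ mat 1ₚ (Ci :* D :* q :- y :* δ) 0ₚ δ
      where δ = (A :* D :- B :* C) :* Ci :* Ci

  upperTriangular∈K₁ : ∀ {N β δ} → Int β → Unit δ → InK1 N (mat 1# β 0# δ)
  upperTriangular∈K₁ {β = β} {δ} β∈𝔬 δ-unit =
    (Unit⇒Int Unit-1 , β∈𝔬 , Int-0 , Unit⇒Int δ-unit , Unit-resp δ≈det δ-unit) ,
    inj₁ refl , inj₁ (-‿inverseʳ 1#)
    where
    δ≈det : δ ≈ 1# * δ - β * 0#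
    δ≈det = solve 2 (λ β δ → δ := 1ₚ :* δ :- β :* 0ₚ) refl β δ

  lLeq-·a : ∀ {N n₀ k} → n₀ ℕ.≤ N → InK k → Unit (e21 k) → InPow (+ 1) (e22 k) →
            lLeq N (k · a (ϖ^ (+ suc n₀))) n₀
  lLeq-·a {N} {n₀} {mat A B C D} n₀≤N (_ , _ , _ , _ , det-unit) C-unit D∈𝔭 =
    decompose (𝔭⁻ⁿ-representative n₀ s∈𝔭⁻ⁿ)
    where
    π = pow ϖ (suc n₀)
    q = ϖ^ -[1+ n₀ ]
    s = C ⁻¹ * D * q
    δ = (A * D - B * C) * C ⁻¹ * C ⁻¹

    δ-unit : Unit δ
    δ-unit = Unit-* (Unit-* det-unit (Unit-⁻¹ C-unit)) (Unit-⁻¹ C-unit)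

    s∈𝔭⁻ⁿ : InPow (ℤ.- + n₀) s
    s∈𝔭⁻ⁿ = P.subst (λ k → InPow k s) (P.trans (ℤP.[1+m]⊖[1+n]≡m⊖n 0 n₀) (ℤP.⊖-≤ ℕ.z≤n))
      (InPow-* (InPow-* (Unit⇒Int (Unit-⁻¹ C-unit)) D∈𝔭) (InPow-ϖ^ -[1+ n₀ ]))

    decompose : ∃[ l ] (l ℕ.≤ n₀ × ∃[ β ] ∃[ u ] (Int β × Unit u × s - β ≈ ϖ^ (ℤ.- + l) * u)) →
                lLeq N (mat A B C D · a π) n₀
    decompose (l , l≤n₀ , β , u , β∈𝔬 , u-unit , s-β≈ϖ⁻ˡu) =
      l , (ℕP.≤-trans l≤n₀ n₀≤N , - (C * π) , A * C ⁻¹ , -[1+ n₀ ] , u * δ ⁻¹ , mat 1# (s - y * δ) 0# δ ,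
           -x≉0 (x*y≉0 (proj₁ C-unit) (pow-≉0 (suc n₀))) , Unit-* u-unit (Unit-⁻¹ δ-unit) ,
           upperTriangular∈K₁ (InPow-resp (sym s-yδ≈β) β∈𝔬) δ-unit ,
           ≈M-sym (bruhatCell (inverse C (proj₁ C-unit)) (inverse π (pow-≉0 (suc n₀))))) ,
      l≤n₀
      where
      y = ϖ^ (ℤ.- + l) * (u * δ ⁻¹)
      s-yδ≈β : s - y * δ ≈ β
      s-yδ≈β = begin
        s - y * δ                          ≈⟨ +-congˡ (-‿cong (*-assoc _ _ δ)) ⟩
        s - ϖ^ (ℤ.- + l) * (u * δ ⁻¹ * δ)  ≈⟨ +-congˡ (-‿cong (*-congˡ ([x*y⁻¹]*y≈x (proj₁ δ-unit)))) ⟩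
        s - ϖ^ (ℤ.- + l) * u               ≈⟨ +-congˡ (-‿cong s-β≈ϖ⁻ˡu) ⟨
        s - (s - β)                        ≈⟨ solve 2 (λ s β → s :- (s :- β) := β) refl s β ⟩
        β                                  ∎
        where open ≈-Reasoning

  InK0p⇒Unit-e22 : ∀ {k} → InK0p k → Unit (e22 k)
  InK0p⇒Unit-e22 ((A∈𝔬 , B∈𝔬 , _ , D∈𝔬 , det-unit) , C∈𝔭) =
    Int∧∉𝔭⇒Unit D∈𝔬 λ D∈𝔭 → Unit⇒∉𝔭 det-unit
      (InPow-+ (InPow-* A∈𝔬 D∈𝔭) (InPow-‿ (InPow-* B∈𝔬 C∈𝔭)) (proj₁ det-unit))

  signedColumnSwap : M2 → M2
  signedColumnSwap (mat A B C D) = mat (- B) A (- D) C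

  InK-signedColumnSwap : ∀ {k} → InK k → InK (signedColumnSwap k)
  InK-signedColumnSwap {mat A B C D} (A∈𝔬 , B∈𝔬 , C∈𝔬 , D∈𝔬 , det-unit) =
    InPow-‿ B∈𝔬 , A∈𝔬 , InPow-‿ D∈𝔬 , C∈𝔬 ,
    Unit-resp (solve 4 (λ A B C D → A :* D :- B :* C := (:- B) :* C :- A :* (:- D)) refl A B C D) det-unit

  one·w·a≈ : ∀ k π → (k · one · w · a π) ≈M (signedColumnSwap k · a π · one · scalar 1#)
  one·w·a≈ (mat A B C D) π =
    solve 5 (λ A B C D π → e11 (lhs A B C D π) := e11 (rhs A B C D π)) refl A B C D π ,
    solve 5 (λ A B C D π → e12 (lhs A B C D π) := e12 (rhs A B C D π)) refl A B C D π ,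
    solve 5 (λ A B C D π → e21 (lhs A B C D π) := e21 (rhs A B C D π)) refl A B C D π ,
    solve 5 (λ A B C D π → e22 (lhs A B C D π) := e22 (rhs A B C D π)) refl A B C D π
    where
    lhs rhs : ∀ {k} (A B C D π : Polynomial k) → Mₚ k
    lhs A B C D π = mat A B C D ·ₚ oneₚ ·ₚ wₚ ·ₚ aₚ π
    rhs A B C D π = mat (:- B) A (:- D) C ·ₚ aₚ π ·ₚ oneₚ ·ₚ scalarₚ 1ₚ

  antidiagonal·w·a≈ : ∀ k {ϖ′ P Q ζ} → P * ζ ≈ 1# → Q ≈ P * P →
    (k · mat 0# 1# ϖ′ 0# · w · a (ϖ′ * P)) ≈M (signedColumnSwap k · a (ϖ′ * P) · mat 0# 1# (ϖ′ * Q) 0# · scalar (- ζ))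
  antidiagonal·w·a≈ (mat A B C D) {ϖ′} {P} {Q} {ζ} Pζ≈1 Q≈PP = ≈M-sym (
    by-relations Pζ≈1 Q≈PP (solve 8 (λ A B C D ϖ P Q ζ →
      e11 (rhs A B C D ϖ P Q ζ) := e11 (lhs A B C D ϖ P) :+
        (:- (A :* ϖ :* P) :* (P :* ζ :- 1ₚ) :+ :- (A :* ϖ :* ζ) :* (Q :- P :* P))) refl A B C D ϖ′ P Q ζ) ,
    by-relations Pζ≈1 Q≈PP (solve 8 (λ A B C D ϖ P Q ζ →
      e12 (rhs A B C D ϖ P Q ζ) := e12 (lhs A B C D ϖ P) :+
        ((B :* ϖ) :* (P :* ζ :- 1ₚ) :+ 0ₚ :* (Q :- P :* P))) refl A B C D ϖ′ P Q ζ) ,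
    by-relations Pζ≈1 Q≈PP (solve 8 (λ A B C D ϖ P Q ζ →
      e21 (rhs A B C D ϖ P Q ζ) := e21 (lhs A B C D ϖ P) :+
        (:- (C :* ϖ :* P) :* (P :* ζ :- 1ₚ) :+ :- (C :* ϖ :* ζ) :* (Q :- P :* P))) refl A B C D ϖ′ P Q ζ) ,
    by-relations Pζ≈1 Q≈PP (solve 8 (λ A B C D ϖ P Q ζ →
      e22 (rhs A B C D ϖ P Q ζ) := e22 (lhs A B C D ϖ P) :+
        ((D :* ϖ) :* (P :* ζ :- 1ₚ) :+ 0ₚ :* (Q :- P :* P))) refl A B C D ϖ′ P Q ζ))
    where
    lhs : ∀ {k} (A B C D ϖ P : Polynomial k) → Mₚ k
    lhs A B C D ϖ P = mat A B C D ·ₚ mat 0ₚ 1ₚ ϖ 0ₚ ·ₚ wₚ ·ₚ aₚ (ϖ :* P)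
    rhs : ∀ {k} (A B C D ϖ P Q ζ : Polynomial k) → Mₚ k
    rhs A B C D ϖ P Q ζ = mat (:- B) A (:- D) C ·ₚ aₚ (ϖ :* P) ·ₚ mat 0ₚ 1ₚ (ϖ :* Q) 0ₚ ·ₚ scalarₚ (:- ζ)

  ·w·a-factorisation : ∀ n₀ k g → g ≡ one ⊎ g ≡ mat 0# 1# ϖ 0# →
    ∃[ g′ ] ∃[ λ′ ] ((g′ ≡ one ⊎ g′ ≡ mat 0# 1# (ϖ^ (+ suc (2 ℕ.* n₀))) 0#) × λ′ ≉ 0# ×
      ((k · g · w · a (ϖ^ (+ suc n₀))) ≈M (signedColumnSwap k · a (ϖ^ (+ suc n₀)) · g′ · scalar λ′)))
  ·w·a-factorisation n₀ k g (inj₁ P.refl) = one , 1# , inj₁ P.refl , 1≉0 , one·w·a≈ k (ϖ^ (+ suc n₀))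
  ·w·a-factorisation n₀ k g (inj₂ P.refl) =
    mat 0# 1# (ϖ^ (+ suc (2 ℕ.* n₀))) 0# , - (pow ϖ n₀ ⁻¹) , inj₂ P.refl , -x≉0 (x⁻¹≉0 (pow-≉0 n₀)) ,
    antidiagonal·w·a≈ k (inverse (pow ϖ n₀) (pow-≉0 n₀)) (pow-2* ϖ n₀)

mainTheorem8 : ∀ {c ℓ} (F : NALocalField c ℓ) → let open GL2 F in
    (N n₀ : ℕ) → N ≡ ℕ.suc (2 ℕ.* n₀) →
    (k g : M2) → InK0p k → (g ≡ one ⊎ g ≡ mat 0# 1# ϖ 0#) →
    ∃[ k′ ] ∃[ g′ ] ∃[ z ]
      (InK k′ × lLeq N (k′ · a (ϖ^ (+ ℕ.suc n₀))) n₀ ×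
       (g′ ≡ one ⊎ g′ ≡ mat 0# 1# (ϖ^ (+ N)) 0#) ×
       (∃[ λ′ ] (¬ (λ′ ≈ 0#) × z ≡ scalar λ′)) ×
       ((k · g · w · a (ϖ^ (+ ℕ.suc n₀))) ≈M (k′ · a (ϖ^ (+ ℕ.suc n₀)) · g′ · z)))
mainTheorem8 F .(ℕ.suc (2 ℕ.* n₀)) n₀ P.refl k g k∈K₀@(k∈K , e21∈𝔭) g∈ =
  let (g′ , λ′ , g′∈ , λ′≉0 , kgwa≈) = ·w·a-factorisation n₀ k g g∈ in
  signedColumnSwap k , g′ , scalar λ′ , InK-signedColumnSwap k∈K ,
  lLeq-·a n₀≤N (InK-signedColumnSwap k∈K) (Unit-‿ (InK0p⇒Unit-e22 k∈K₀)) e21∈𝔭 ,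
  g′∈ , (λ′ , λ′≉0 , P.refl) , kgwa≈
  where
  open GL2 F
  open GL2Properties F
  open LocalFieldProperties F using (Unit-‿)
  n₀≤N : n₀ ℕ.≤ ℕ.suc (2 ℕ.* n₀)
  n₀≤N = ℕP.≤-trans (ℕP.m≤m+n n₀ _) (ℕP.n≤1+n _)
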